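{- Let $k,l,n$ be positive integers. Then $$\binom{kn+ln}{kn}\equiv 0\ \left(\mathrm{mod}\ \frac{ln+1}{\gcd(k,ln+1)}\right).$$ In particular, $(ln+1)\mid\binom{kn+ln}{kn}$ if every prime factor of $k$ divides $l$. -}

module Defs where

open import Data.Nat using (ℕ; zero; suc; _/_; ≢-nonZero; NonZero)
open import Data.Nat.GCD using (gcd; gcd[m,n]≢0)
open import Data.Sum using (inj₂)

quotGcd : (k m : ℕ) → {{NonZero m}} → ℕ
quotGcd k (suc m) = (suc m / gcd k (suc m)) {{≢-nonZero (gcd[m,n]≢0 k (suc m) (inj₂ λ ()))}}

module Submission where

-- Write a = kn and b = ln, so the binomial coefficient is C = (a+b choose a).
--
-- 1. Absorption identity: (k+1)·(n+1 choose k+1) = (n+1)·(n choose k).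
--    Taken at n = a+b, k = b it reads (b+1)·(a+b+1 choose b+1) = (a+b+1)·C,
--    and since a+b+1 = (b+1)+a this gives (b+1) ∣ a·C.
-- 2. For a = kn, b = ln the factor n of a is coprime to ln+1 (any common
--    divisor also divides 1), so ln+1 ∣ k·C.
-- 3. Reduction to lowest terms: if m ∣ k·x then m/gcd(k,m) ∣ x, because
--    m/gcd(k,m) is coprime to k/gcd(k,m).

open import Defs
open import Data.Nat using (ℕ; suc; _+_; _*_; NonZero)
open import Data.Nat.Divisibility using (_∣_)
open import Data.Nat.Combinatorics using (_C_)
open import Data.Nat.Primality using (Prime)
open import Data.Product using (_×_)

open import Data.Nat.Base using (zero; ≢-nonZero)
open import Data.Nat.Properties
  using (*-zeroʳ; *-identityˡ; *-identityʳ; *-comm; *-assoc; +-comm; *-distribʳ-+; m≤m+n; m+n∸m≡n)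
open import Data.Nat.Divisibility
  using (divides; 0∣⇒≡0; ∣-trans; ∣1⇒≡1; ∣m+n∣m⇒∣n; m∣m*n; n∣m*n; *-cancelˡ-∣)
open import Data.Nat.Combinatorics using (nC1≡n; nCk≡nC[n∸k]; nCk+nC[k+1]≡[n+1]C[k+1])
open import Data.Nat.GCD using (gcd; gcd[m,n]≢0; gcd[m,n]∣m; gcd[m,n]∣n)
open import Data.Nat.Coprimality using (Coprime; coprime-/gcd; coprime-divisor)
import Data.Nat.Coprimality as Coprime
open import Data.Nat.DivMod using (_/_; m*[n/m]≡n)
open import Data.Nat.Primality using (¬prime[1])
open import Data.Nat.Primality.Factorisation using (PrimeFactorisation; factorise)
open import Data.List.Base using ([]; _∷_)
open import Data.List.Relation.Unary.All using (_∷_)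
open import Data.Product using (_,_)
open import Data.Sum using (inj₂)
open import Relation.Binary.PropositionalEquality
  using (_≡_; refl; sym; trans; cong; cong₂; subst; subst₂; module ≡-Reasoning)
open import Data.Nat.Tactic.RingSolver using (solve-∀)
open import Relation.Nullary.Negation using (contradiction)

-- The algebra behind one induction step of the absorption identity: with
-- x = (n+1 choose k+1), y = (n+1 choose k+2), u = (n choose k), v = (n choose k+1),
-- the two induction hypotheses and Pascal's rule u + v = x give the claim.
absorption-step : ∀ n k x y u v →
  suc k * x ≡ suc n * u → suc (suc k) * y ≡ suc n * v → u + v ≡ x →
  suc (suc k) * (x + y) ≡ suc (suc n) * x
absorption-step n k x y u v ihₓ ihᵧ pascal = begin
  suc (suc k) * (x + y)            ≡⟨ distribute k x y ⟩
  suc k * x + x + suc (suc k) * y  ≡⟨ cong₂ (λ s t → s + x + t) ihₓ ihᵧ ⟩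
  suc n * u + x + suc n * v        ≡⟨ collect n x u v ⟩
  suc n * (u + v) + x              ≡⟨ cong (λ s → suc n * s + x) pascal ⟩
  suc n * x + x                    ≡⟨ +-comm (suc n * x) x ⟩
  suc (suc n) * x                  ∎
  where
  open ≡-Reasoning
  distribute : ∀ k x y → suc (suc k) * (x + y) ≡ suc k * x + x + suc (suc k) * y
  distribute = solve-∀
  collect : ∀ n x u v → suc n * u + x + suc n * v ≡ suc n * (u + v) + x
  collect = solve-∀

absorption : ∀ n k → suc k * (suc n C suc k) ≡ suc n * (n C k)
absorption zero    zero    = refl
absorption zero    (suc k) = *-zeroʳ (suc (suc k))
absorption (suc n) zero    =
  trans (*-identityˡ _) (trans (nC1≡n (suc (suc n))) (sym (*-identityʳ (suc (suc n)))))
absorption (suc n) (suc k) =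
  trans (cong (suc (suc k) *_) (sym (nCk+nC[k+1]≡[n+1]C[k+1] (suc n) (suc k))))
        (absorption-step n k (suc n C suc k) (suc n C suc (suc k)) (n C k) (n C suc k)
          (absorption n k) (absorption n (suc k)) (nCk+nC[k+1]≡[n+1]C[k+1] n k))

choose-swap : ∀ a b → (a + b) C a ≡ (a + b) C b
choose-swap a b = trans (nCk≡nC[n∸k] (m≤m+n a b)) (cong ((a + b) C_) (m+n∸m≡n a b))

-- Step 1: (b+1) ∣ a·(a+b choose a).  Absorption shows (b+1) ∣ (a+b+1)·C, and
-- (a+b+1)·C = (b+1)·C + a·C.
suc-∣-mul-choose : ∀ a b → suc b ∣ a * ((a + b) C a)
suc-∣-mul-choose a b = ∣m+n∣m⇒∣n (subst (suc b ∣_) split absorbed) (m∣m*n c)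
  where
  c = (a + b) C a
  absorbed : suc b ∣ suc (a + b) * c
  absorbed = divides (suc (a + b) C suc b) (begin
    suc (a + b) * c                     ≡⟨ cong (suc (a + b) *_) (choose-swap a b) ⟩
    suc (a + b) * ((a + b) C b)         ≡⟨ sym (absorption (a + b) b) ⟩
    suc b * (suc (a + b) C suc b)       ≡⟨ *-comm (suc b) _ ⟩
    (suc (a + b) C suc b) * suc b       ∎)
    where open ≡-Reasoning
  split : suc (a + b) * c ≡ suc b * c + a * c
  split = trans (cong (λ s → suc s * c) (+-comm a b)) (*-distribʳ-+ c (suc b) a)

∣-suc-and-∣⇒≡1 : ∀ {d b} → d ∣ suc b → d ∣ b → d ≡ 1
∣-suc-and-∣⇒≡1 {d} {b} d∣1+b d∣b = ∣1⇒≡1 (∣m+n∣m⇒∣n (subst (d ∣_) (+-comm 1 b) d∣1+b) d∣b)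

coprime-suc-mul : ∀ l n → Coprime (suc (l * n)) n
coprime-suc-mul l n (d∣1+ln , d∣n) = ∣-suc-and-∣⇒≡1 d∣1+ln (∣-trans d∣n (n∣m*n l))

quotGcd-∣ : ∀ k m x → suc m ∣ k * x → quotGcd k (suc m) ∣ x
quotGcd-∣ k m x m∣kx =
  coprime-divisor (Coprime.sym (coprime-/gcd k (suc m))) (*-cancelˡ-∣ g reduced)
  where
  g = gcd k (suc m)
  instance
    g≢0 : NonZero g
    g≢0 = ≢-nonZero (gcd[m,n]≢0 k (suc m) (inj₂ λ ()))
  reduced : g * (suc m / g) ∣ g * ((k / g) * x)
  reduced = subst₂ _∣_ (sym (m*[n/m]≡n (gcd[m,n]∣n k (suc m))))
    (trans (cong (_* x) (sym (m*[n/m]≡n (gcd[m,n]∣m k (suc m))))) (*-assoc g (k / g) x))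
    m∣kx

-- Step 4: if every prime factor of k divides b, then b+1 is coprime to k.
-- A common divisor d is nonzero; if it had a prime factor p, then p would
-- divide both b and b+1, forcing p = 1.
coprime-suc-of-primes : ∀ k b → (∀ p → Prime p → p ∣ k → p ∣ b) → Coprime (suc b) k
coprime-suc-of-primes k b primes∣b {d} (d∣1+b , d∣k) = noPrimeFactor (factorise d {{d≢0}})
  where
  d≢0 : NonZero d
  d≢0 = ≢-nonZero λ { refl → contradiction (0∣⇒≡0 d∣1+b) λ () }
  noPrimeFactor : PrimeFactorisation d → d ≡ 1
  noPrimeFactor record { factors = [] ; isFactorisation = d≡1 } = d≡1
  noPrimeFactor record { factors = p ∷ ps ; isFactorisation = d≡p*ps ; factorsPrime = p-prime ∷ _ } =
    contradiction (subst Prime (∣-suc-and-∣⇒≡1 (∣-trans p∣d d∣1+b) p∣b) p-prime) ¬prime[1]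
    where
    p∣d : p ∣ d
    p∣d = subst (p ∣_) (sym d≡p*ps) (m∣m*n _)
    p∣b : p ∣ b
    p∣b = primes∣b p p-prime (∣-trans p∣d d∣k)

-- Theorem 1.4: (ln+1)/gcd(k, ln+1) divides (kn+ln choose kn), and ln+1
-- itself divides it when every prime factor of k divides l.  The argument
-- does not use the positivity hypotheses.
theorem1p4 : (k l n : ℕ) → NonZero k → NonZero l → NonZero n →
    (quotGcd k (suc (l * n)) ∣ ((k * n + l * n) C (k * n)))
    × ((∀ (p : ℕ) → Prime p → p ∣ k → p ∣ l) →
    suc (l * n) ∣ ((k * n + l * n) C (k * n)))
theorem1p4 k l n _ _ _ = quotGcd-∣ k (l * n) c 1+ln∣k*c , cancelK
  where
  c = (k * n + l * n) C (k * n)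
  1+ln∣k*c : suc (l * n) ∣ k * c
  1+ln∣k*c = coprime-divisor (coprime-suc-mul l n)
    (subst (suc (l * n) ∣_) (trans (cong (_* c) (*-comm k n)) (*-assoc n k c))
      (suc-∣-mul-choose (k * n) (l * n)))
  cancelK : (∀ p → Prime p → p ∣ k → p ∣ l) → suc (l * n) ∣ c
  cancelK primes∣l = coprime-divisor
    (coprime-suc-of-primes k (l * n) λ p p-prime p∣k → ∣-trans (primes∣l p p-prime p∣k) (m∣m*n n))
    1+ln∣k*c
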